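{- For any two different classes $\mathcal{C}\neq\mathcal{C}'$ in $\{\mathrm{Horn},\mathrm{dHorn},\mathrm{Krom}\}$, the parameters $\mathrm{size}_{\mathcal{C}\oplus\mathcal{C}'}$ and $\mathrm{depth}_{\mathcal{C}}$ are domination orthogonal.
   Context: A clause is a finite set of literals with no complementary pair; a CNF formula is a finite set of clauses. For a partial assignment $\tau$, $F[\tau]$ is obtained by deleting clauses containing a true literal and deleting false literals from the remaining clauses. $\mathrm{Conn}(F)$ is the set of connected components of $F$ with respect to its incidence graph (bipartite graph between variables and clauses, $x$ adjacent to $c$ iff $x$ or $\neg x$ is in $c$). Horn: every clause has at most one positive literal; dHorn: at most one negative literal; Krom: at most two literals. $\mathcal{C}\oplus\mathcal{C}'$ is the class of CNF formulas $F$ such that each $F'\in\mathrm{Conn}(F)$ belongs to $\mathcal{C}$ or to $\mathcal{C}'$. $\mathrm{depth}_{\mathcal{C}}(F)$ is $0$ if $F\in\mathcal{C}$; if $F\notin\mathcal{C}$ and $F$ is connected it is $1+\min_{x\in\mathit{var}(F)}\max_{\epsilon\in\{0,1\}}\mathrm{depth}_{\mathcal{C}}(F[x=\epsilon])$; otherwise it is $\max_{F'\in\mathrm{Conn}(F)}\mathrm{depth}_{\mathcal{C}}(F')$. For a class $\mathcal{D}$, $\mathrm{size}_{\mathcal{D}}(F)$ is the minimum size of a set $B\subseteq\mathit{var}(F)$ with $F[\tau]\in\mathcal{D}$ for all $\tau:B\to\{0,1\}$. For integer-valued parameters $p,q$: $p$ dominates $q$ if every class of formulas on which $q$ is bounded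 also has $p$ bounded; $p,q$ are domination orthogonal if neither dominates the other. -}

module Defs where

open import Data.Nat using (ℕ; zero; suc; _≤_; _≟_)
open import Data.Bool using (Bool; true; false; if_then_else_; not)
open import Data.Maybe using (Maybe; just; nothing)
import Data.Maybe as Maybe
open import Data.List using (List; []; _∷_; length; map; concatMap)
open import Data.List.Membership.Propositional using (_∈_)
open import Data.List.Membership.DecPropositional _≟_ using (_∈?_)
open import Data.List.Relation.Unary.All using (All)
open import Data.List.Relation.Unary.Unique.Propositional using (Unique)
open import Data.Product using (_×_; _,_; proj₁; ∃; Σ)
open import Data.Sum using (_⊎_)
open import Data.Empty using (⊥)
open import Relation.Nullary using (¬_; does)
open import Relation.Binary.PropositionalEquality using (_≡_)

-- Literals, clauses, formulas
-- A literal is a variable (a natural number) with a sign;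
-- sign true = positive literal x, sign false = negative literal ¬x.

Lit : Set
Lit = ℕ × Bool

Clause : Set
Clause = List Lit

Formula : Set
Formula = List Clause

WFClause : Clause → Set
WFClause c = Unique c × (∀ x → (x , true) ∈ c → (x , false) ∈ c → ⊥)

WF : Formula → Set
WF F = All WFClause F

varsC : Clause → List ℕ
varsC c = map proj₁ c

vars : Formula → List ℕ
vars F = concatMap varsC F

Assignment : Set
Assignment = ℕ → Maybe Bool

evalLit : Assignment → Lit → Maybe Bool
evalLit τ (x , s) = Maybe.map (λ b → if s then b else not b) (τ x)

-- nothing  = the clause is satisfied (deleted);
-- just c'  = the clause with its false literals deleted
reduceClause : Assignment → Clause → Maybe Clause
reduceClause τ [] = just []
reduceClause τ (l ∷ c) with evalLit τ l
... | just true  = nothing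
... | just false = reduceClause τ c
... | nothing    = Maybe.map (l ∷_) (reduceClause τ c)

restrict : Formula → Assignment → Formula
restrict [] τ = []
restrict (c ∷ F) τ with reduceClause τ c
... | nothing = restrict F τ
... | just c' = c' ∷ restrict F τ

single : ℕ → Bool → Assignment
single x ε y = if does (y ≟ x) then just ε else nothing

onSet : List ℕ → (ℕ → Bool) → Assignment
onSet B σ y = if does (y ∈? B) then just (σ y) else nothing

countPos : Clause → ℕ
countPos [] = 0
countPos ((x , true) ∷ c) = suc (countPos c)
countPos ((x , false) ∷ c) = countPos c

countNeg : Clause → ℕ
countNeg [] = 0
countNeg ((x , true) ∷ c) = countNeg c
countNeg ((x , false) ∷ c) = suc (countNeg c)

Horn : Formula → Set
Horn F = All (λ c → countPos c ≤ 1) F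

dHorn : Formula → Set
dHorn F = All (λ c → countNeg c ≤ 1) F

Krom : Formula → Set
Krom F = All (λ c → length c ≤ 2) F

data BaseClass : Set where
  horn dhorn krom : BaseClass

⟦_⟧ : BaseClass → Formula → Set
⟦ horn ⟧ = Horn
⟦ dhorn ⟧ = dHorn
⟦ krom ⟧ = Krom

-- Incidence-graph connectivity.  Clauses c, d are joined by a path
-- c - x - d in the incidence graph iff they share a variable x.

Adjacent : Clause → Clause → Set
Adjacent c d = ∃ λ x → x ∈ varsC c × x ∈ varsC d

data Reach (F : Formula) (c : Clause) : Clause → Set where
  here : c ∈ F → Reach F c c
  step : ∀ {d e} → Reach F c d → e ∈ F → Adjacent d e → Reach F c e

Connected : Formula → Set
Connected F = ∀ c d → c ∈ F → d ∈ F → Reach F c d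

IsComponent : Formula → Formula → Set
IsComponent G F =
  (∀ c → c ∈ G → c ∈ F) ×
  (∃ λ c → c ∈ G) ×
  (∀ c d → c ∈ G → d ∈ F → Reach F c d → d ∈ G) ×
  (∀ c d → c ∈ G → d ∈ G → Reach F c d)

_⊕_ : (Formula → Set) → (Formula → Set) → Formula → Set
(C ⊕ C') F = ∀ G → IsComponent G F → C G ⊎ C' G

-- Parameters, given as "p(F) ≤ k" relations.

data DepthLe (C : Formula → Set) : ℕ → Formula → Set where
  inC   : ∀ {k F} → C F → DepthLe C k F
  split : ∀ {k F} x → ¬ C F → Connected F → x ∈ vars F →
          DepthLe C k (restrict F (single x false)) →
          DepthLe C k (restrict F (single x true)) →
          DepthLe C (suc k) F
  comps : ∀ {k F} → ¬ C F → ¬ Connected F →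
          (∀ G → IsComponent G F → DepthLe C k G) →
          DepthLe C k F

SizeLe : (Formula → Set) → ℕ → Formula → Set
SizeLe D k F = Σ (List ℕ) λ B →
  Unique B × All (_∈ vars F) B × length B ≤ k ×
  (∀ (σ : ℕ → Bool) → D (restrict F (onSet B σ)))

Parameter : Set₁
Parameter = ℕ → Formula → Set

Bounded : Parameter → (Formula → Set) → Set
Bounded p 𝒦 = ∃ λ k → ∀ F → 𝒦 F → p k F

Dominates : Parameter → Parameter → Set₁
Dominates p q = ∀ (𝒦 : Formula → Set) → (∀ F → 𝒦 F → WF F) →
  Bounded q 𝒦 → Bounded p 𝒦

DominationOrthogonal : Parameter → Parameter → Set₁
DominationOrthogonal p q = ¬ Dominates p q × ¬ Dominates q p

{-# OPTIONS --safe #-}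
-- Two kinds of families separate the parameters.  A single long clause whose
-- literals all have one sign, or the clique of binary clauses of one sign on n
-- variables, lies in 𝒞' (the empty backdoor witnesses size 0), yet it is connected,
-- lies outside 𝒞, and for every variable one of its two values leaves a member of
-- the same family on one variable fewer; so depth_𝒞 grows with n.  Conversely, n
-- variable-disjoint copies of a gadget clause that lies in neither 𝒞 nor 𝒞' but
-- falls into 𝒞 once its first variable is set have depth_𝒞 one, whereas a set of
-- fewer than n variables misses some gadget, which then remains an isolated
-- component outside 𝒞 ⊕ 𝒞'.

module Submission where

open import Defs

open import Data.Nat using (ℕ; suc; _+_; _*_; _/_; _≤_; _<_; _≟_; _≡ᵇ_; z≤n; s≤s; NonZero)
open import Data.Bool using (Bool; true; false; not)
open import Data.Empty using (⊥-elim)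
open import Data.List using (List; []; _∷_; length; map; concatMap; filter; upTo)
open import Data.List.Membership.Propositional using (_∈_; _∉_; find; lose)
open import Data.List.Membership.Propositional.Properties
  using (∈-map⁺; ∈-map⁻; ∈-++⁺ˡ; ∈-++⁺ʳ; ∈-filter⁺; ∈-filter⁻; ∈-concatMap⁺; ∈-concatMap⁻; ∈-upTo⁺; ∈-upTo⁻)
open import Data.List.Membership.DecPropositional _≟_ using (_∈?_)
open import Data.List.Properties using (filter-notAll; length-upTo; length-map)
open import Data.List.Relation.Binary.Subset.Propositional using (_⊆_)
open import Data.List.Relation.Unary.All as All using (All; []; _∷_; all?)
open import Data.List.Relation.Unary.All.Properties using (¬All⇒Any¬) renaming (map⁺ to All-map⁺)
open import Data.List.Relation.Unary.AllPairs using ([]; _∷_)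
open import Data.List.Relation.Unary.Any as Any using (here; there)
open import Data.List.Relation.Unary.Unique.Propositional using (Unique)
import Data.List.Relation.Unary.Unique.Propositional.Properties as Unique
open import Data.Maybe using (just; nothing)
open import Data.Nat.Properties
  using (≤-refl; ≤-reflexive; ≤-trans; ≤-<-trans; ≤-pred; <⇒≱; +-suc; m+1+n≢n; n<1+n; m≤n⇒m≤1+n; module ≤-Reasoning)
open import Data.Nat.DivMod using (+-distrib-/-∣ʳ; m<n⇒m/n≡0; m*n/n≡m)
open import Data.Nat.Divisibility using (divides-refl)
open import Data.Product using (_×_; _,_; proj₁; proj₂; ∃; ∃₂)
open import Data.Sum using (inj₁; inj₂)
open import Relation.Nullary using (¬_; yes; no)
open import Relation.Nullary.Decidable using (dec-true; dec-false; ¬?)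
open import Relation.Binary.PropositionalEquality
  using (_≡_; _≢_; refl; sym; trans; cong; cong₂; subst; ≢-sym; module ≡-Reasoning)

single-self : ∀ x ε → single x ε x ≡ just ε
single-self x ε rewrite dec-true (x ≟ x) refl = refl

single-≢ : ∀ {x y} ε → y ≢ x → single x ε y ≡ nothing
single-≢ {x} {y} ε y≢x rewrite dec-false (y ≟ x) y≢x = refl

onSet-∉ : ∀ {B y} σ → y ∉ B → onSet B σ y ≡ nothing
onSet-∉ {B} {y} σ y∉B rewrite dec-false (y ∈? B) y∉B = refl

evalLit-single-agree : ∀ x s → evalLit (single x s) (x , s) ≡ just true
evalLit-single-agree x true rewrite single-self x true = refl
evalLit-single-agree x false rewrite single-self x false = refl

Untouched : Assignment → Clause → Set
Untouched τ c = All (λ l → τ (proj₁ l) ≡ nothing) c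

untouched-varsC : ∀ {τ c} → (∀ {y} → y ∈ varsC c → τ y ≡ nothing) → Untouched τ c
untouched-varsC free = All.tabulate λ l∈c → free (∈-map⁺ proj₁ l∈c)

reduceClause-untouched : ∀ τ {c} → Untouched τ c → reduceClause τ c ≡ just c
reduceClause-untouched τ [] = refl
reduceClause-untouched τ {(x , s) ∷ c} (τx ∷ u) rewrite τx | reduceClause-untouched τ u = refl

restrict-untouched : ∀ F τ → (∀ y → τ y ≡ nothing) → restrict F τ ≡ F
restrict-untouched [] τ free = refl
restrict-untouched (c ∷ F) τ free
  rewrite reduceClause-untouched τ (All.tabulate {xs = c} λ _ → free _) | restrict-untouched F τ free = refl

reduceClause-satisfied : ∀ {x s c} → (x , s) ∈ c → reduceClause (single x s) c ≡ nothing
reduceClause-satisfied {x} {s} (here refl) rewrite evalLit-single-agree x s = refl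
reduceClause-satisfied {x} {s} {l ∷ c} (there p) with evalLit (single x s) l
... | just true  = refl
... | just false = reduceClause-satisfied p
... | nothing    rewrite reduceClause-satisfied {c = c} p = refl

reduceClause-dropHead : ∀ τ x b {c c'} ε → τ x ≡ just ε → Untouched τ c →
  reduceClause τ ((x , b) ∷ c) ≡ just c' → c' ≡ c
reduceClause-dropHead τ x true  true  τx u eq rewrite τx with () ← eq
reduceClause-dropHead τ x true  false τx u eq rewrite τx | reduceClause-untouched τ u with refl ← eq = refl
reduceClause-dropHead τ x false true  τx u eq rewrite τx | reduceClause-untouched τ u with refl ← eq = refl
reduceClause-dropHead τ x false false τx u eq rewrite τx with () ← eq

reduceClause-varsC : ∀ τ c {c' v} → reduceClause τ c ≡ just c' → v ∈ varsC c' → v ∈ varsC c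
reduceClause-varsC τ [] refl ()
reduceClause-varsC τ (l ∷ c) eq v∈c' with evalLit τ l
... | just false = there (reduceClause-varsC τ c eq v∈c')
reduceClause-varsC τ (l ∷ c) eq v∈c' | nothing with reduceClause τ c in eq-c
reduceClause-varsC τ (l ∷ c) refl (here refl)  | nothing | just _ = here refl
reduceClause-varsC τ (l ∷ c) refl (there v∈c') | nothing | just _ = there (reduceClause-varsC τ c eq-c v∈c')

restrict-∈⁺ : ∀ F τ {c c'} → c ∈ F → reduceClause τ c ≡ just c' → c' ∈ restrict F τ
restrict-∈⁺ (d ∷ F) τ (here refl) eq rewrite eq = here refl
restrict-∈⁺ (d ∷ F) τ (there c∈F) eq with reduceClause τ d
... | nothing = restrict-∈⁺ F τ c∈F eq
... | just _  = there (restrict-∈⁺ F τ c∈F eq)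

restrict-∈⁻ : ∀ F τ {c'} → c' ∈ restrict F τ → ∃ λ c → c ∈ F × reduceClause τ c ≡ just c'
restrict-∈⁻ (d ∷ F) τ c'∈ with reduceClause τ d in eq
restrict-∈⁻ (d ∷ F) τ c'∈          | nothing = let c , c∈F , e = restrict-∈⁻ F τ c'∈ in c , there c∈F , e
restrict-∈⁻ (d ∷ F) τ (here refl)  | just _  = d , here refl , eq
restrict-∈⁻ (d ∷ F) τ (there c'∈)  | just _  = let c , c∈F , e = restrict-∈⁻ F τ c'∈ in c , there c∈F , e

All-restrict : ∀ {P : Clause → Set} F τ →
  (∀ {c c'} → c ∈ F → reduceClause τ c ≡ just c' → P c') → All P (restrict F τ)
All-restrict F τ h = All.tabulate λ c'∈ → let _ , c∈F , eq = restrict-∈⁻ F τ c'∈ in h c∈F eq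

vars-∈ : ∀ F {c v} → c ∈ F → v ∈ varsC c → v ∈ vars F
vars-∈ (c ∷ F) (here refl) v∈c = ∈-++⁺ˡ v∈c
vars-∈ (c ∷ F) (there c∈F) v∈c = ∈-++⁺ʳ (varsC c) (vars-∈ F c∈F v∈c)

Isolated : Formula → Clause → Set
Isolated F c = ∀ {d} → d ∈ F → Adjacent c d → d ≡ c

reach-isolated : ∀ {F c d} → Isolated F c → Reach F c d → d ≡ c
reach-isolated iso (here _) = refl
reach-isolated iso (step r e∈F adj) with refl ← reach-isolated iso r = iso e∈F adj

isolated-restrict : ∀ {F c} τ → Isolated F c → Untouched τ c → Isolated (restrict F τ) c
isolated-restrict {F} {c} τ iso u d'∈ (x , x∈c , x∈d') with restrict-∈⁻ F τ d'∈
... | d , d∈F , eq with refl ← iso d∈F (x , x∈c , reduceClause-varsC τ d eq x∈d')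
                   with refl ← trans (sym (reduceClause-untouched τ u)) eq = refl

isolated⇒component : ∀ {F c} → c ∈ F → Isolated F c → IsComponent (c ∷ []) F
isolated⇒component c∈F iso =
  (λ { _ (here refl) → c∈F }) ,
  (_ , here refl) ,
  (λ { _ _ (here refl) _ r → here (reach-isolated iso r) }) ,
  (λ { _ _ (here refl) (here refl) → here c∈F })

component-isolated : ∀ {F G c d} → IsComponent G F → c ∈ G → Isolated F c → d ∈ G → d ≡ c
component-isolated (_ , _ , _ , connected) c∈G iso d∈G = reach-isolated iso (connected _ _ c∈G d∈G)

distinctVars-≡ : ∀ {c a b} → Unique (varsC c) → a ∈ c → b ∈ c → proj₁ a ≡ proj₁ b → a ≡ b
distinctVars-≡ (_ ∷ _) (here refl) (here refl) _ = refl
distinctVars-≡ (a∉ ∷ _) (here refl) (there b∈c) e = ⊥-elim (All.lookup a∉ (∈-map⁺ proj₁ b∈c) e)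
distinctVars-≡ (b∉ ∷ _) (there a∈c) (here refl) e = ⊥-elim (All.lookup b∉ (∈-map⁺ proj₁ a∈c) (sym e))
distinctVars-≡ (_ ∷ u) (there a∈c) (there b∈c) e = distinctVars-≡ u a∈c b∈c e

distinctVars⇒WF : ∀ {c} → Unique (varsC c) → WFClause c
distinctVars⇒WF u = Unique.map⁻ u , λ x pos neg → true≢false (cong proj₂ (distinctVars-≡ u pos neg refl))
  where
  true≢false : true ≢ false
  true≢false ()

remove : ℕ → List ℕ → List ℕ
remove x = filter (λ y → ¬? (y ≟ x))

∈-remove⁺ : ∀ {x y S} → y ∈ S → y ≢ x → y ∈ remove x S
∈-remove⁺ = ∈-filter⁺ (λ y → ¬? (y ≟ _))

∈-remove⁻ : ∀ x S {y} → y ∈ remove x S → y ∈ S × y ≢ x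
∈-remove⁻ x S = ∈-filter⁻ (λ y → ¬? (y ≟ x)) {xs = S}

remove-unique : ∀ x {S} → Unique S → Unique (remove x S)
remove-unique x = Unique.filter⁺ (λ y → ¬? (y ≟ x))

length-remove< : ∀ {x} S → x ∈ S → length (remove x S) < length S
length-remove< S x∈S = filter-notAll (λ y → ¬? (y ≟ _)) S (Any.map (λ x≡y y≢x → y≢x (sym x≡y)) x∈S)

unique⊆⇒length≤ : ∀ {xs ys : List ℕ} → Unique xs → xs ⊆ ys → length xs ≤ length ys
unique⊆⇒length≤ {[]} _ _ = z≤n
unique⊆⇒length≤ {x ∷ xs} {ys} (x∉xs ∷ u) xs⊆ys = begin-strict
  length xs            ≤⟨ unique⊆⇒length≤ u xs⊆remove ⟩
  length (remove x ys) <⟨ length-remove< ys (xs⊆ys (here refl)) ⟩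
  length ys            ∎
  where
  open ≤-Reasoning
  xs⊆remove : xs ⊆ remove x ys
  xs⊆remove y∈xs = ∈-remove⁺ (xs⊆ys (there y∈xs)) (≢-sym (All.lookup x∉xs y∈xs))

length≤suc-remove : ∀ x {S} → Unique S → length S ≤ suc (length (remove x S))
length≤suc-remove x u = unique⊆⇒length≤ u S⊆x∷remove
  where
  S⊆x∷remove : ∀ {y S} → y ∈ S → y ∈ x ∷ remove x S
  S⊆x∷remove {y} y∈S with y ≟ x
  ... | yes refl = here refl
  ... | no y≢x   = there (∈-remove⁺ y∈S y≢x)

upTo-missing : ∀ n (xs : List ℕ) → length xs < n → ∃ λ i → i < n × i ∉ xs
upTo-missing n xs xs<n with all? (_∈? xs) (upTo n)
... | yes upTo⊆xs = ⊥-elim (<⇒≱ xs<n (begin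
  n                 ≡⟨ length-upTo n ⟨
  length (upTo n)   ≤⟨ unique⊆⇒length≤ (Unique.upTo⁺ n) (All.lookup upTo⊆xs) ⟩
  length xs         ∎))
  where open ≤-Reasoning
... | no ¬upTo⊆xs =
  let i , i∈upTo , i∉xs = find (¬All⇒Any¬ (_∈? xs) (upTo n) ¬upTo⊆xs) in i , ∈-upTo⁻ i∈upTo , i∉xs

¬Dominates-family : ∀ (p q : Parameter) (fam : ℕ → Formula) k → (∀ m → WF (fam m)) →
  (∀ m → q k (fam m)) → (∀ m → ¬ p m (fam m)) → ¬ Dominates p q
¬Dominates-family p q fam k wf q≤k p>m dominates =
  let m , p≤ = dominates (λ F → ∃ λ m → F ≡ fam m) (λ { _ (m , refl) → wf m })
                         (k , λ { _ (m , refl) → q≤k m })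
  in p>m m (p≤ (fam m) (m , refl))

module DepthLowerBound {C : Formula → Set} (I : ℕ → Formula → Set)
  (I⇒¬C : ∀ {m F} → I m F → ¬ C F) (I⇒connected : ∀ {m F} → I m F → Connected F)
  (I-restrict : ∀ {m F} x → I (suc m) F → ∃ λ ε → I m (restrict F (single x ε))) where

  ¬DepthLe : ∀ {k F} → I k F → ¬ DepthLe C k F
  ¬DepthLe i (inC c) = I⇒¬C i c
  ¬DepthLe i (split x _ _ _ d₀ d₁) with I-restrict x i
  ... | false , i' = ¬DepthLe i' d₀
  ... | true  , i' = ¬DepthLe i' d₁
  ¬DepthLe i (comps _ disconnected _) = disconnected (I⇒connected i)

SizeLe-zero : ∀ (D : Formula → Set) {Q : Clause → Set} F → All Q F → SizeLe (D ⊕ All Q) 0 F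
SizeLe-zero D {Q} F allQ = [] , [] , [] , z≤n , λ σ →
  subst (D ⊕ All Q) (sym (restrict-untouched F (onSet [] σ) λ _ → refl))
    λ G (G⊆F , _) → inj₂ (All.tabulate λ c∈G → All.lookup allQ (G⊆F _ c∈G))

-- Long clauses and cliques: unbounded depth, empty backdoors

clauseOn : Bool → List ℕ → Clause
clauseOn s = map (_, s)

varsC-clauseOn : ∀ s S → varsC (clauseOn s S) ≡ S
varsC-clauseOn s [] = refl
varsC-clauseOn s (x ∷ S) = cong (x ∷_) (varsC-clauseOn s S)

-- Once _≟_ is unfolded, single and remove both branch on y ≡ᵇ x, so a single
-- case split on it evaluates both sides.
reduceClause-clauseOn : ∀ s x S →
  reduceClause (single x (not s)) (clauseOn s S) ≡ just (clauseOn s (remove x S))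
reduceClause-clauseOn s x [] = refl
reduceClause-clauseOn true x (y ∷ S) with y ≡ᵇ x
... | true  = reduceClause-clauseOn true x S
... | false rewrite reduceClause-clauseOn true x S = refl
reduceClause-clauseOn false x (y ∷ S) with y ≡ᵇ x
... | true  = reduceClause-clauseOn false x S
... | false rewrite reduceClause-clauseOn false x S = refl

LongClause : Bool → ℕ → Formula → Set
LongClause s m F = ∃ λ S → F ≡ clauseOn s S ∷ [] × Unique S × 3 + m ≤ length S

longClauseFamily : Bool → ℕ → Formula
longClauseFamily s m = clauseOn s (upTo (3 + m)) ∷ []

longClauseFamily-invariant : ∀ s m → LongClause s m (longClauseFamily s m)
longClauseFamily-invariant s m = upTo (3 + m) , refl , Unique.upTo⁺ _ , ≤-reflexive (sym (length-upTo _))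

longClauseFamily-WF : ∀ s m → WF (longClauseFamily s m)
longClauseFamily-WF s m = distinctVars⇒WF (subst Unique (sym (varsC-clauseOn s _)) (Unique.upTo⁺ _)) ∷ []

LongClause-connected : ∀ {s m F} → LongClause s m F → Connected F
LongClause-connected (_ , refl , _) _ _ (here refl) (here refl) = here (here refl)

LongClause-restrict : ∀ s {m F} x →
  LongClause s (suc m) F → LongClause s m (restrict F (single x (not s)))
LongClause-restrict s x (S , refl , u , len) rewrite reduceClause-clauseOn s x S =
  remove x S , refl , remove-unique x u , ≤-pred (≤-trans len (length≤suc-remove x u))

¬Dominates-depth-size-longClause : ∀ s (P Q : Clause → Set) →
  (∀ {x y z} S → ¬ P (clauseOn s (x ∷ y ∷ z ∷ S))) → (∀ S → Q (clauseOn s S)) →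
  ¬ Dominates (DepthLe (All P)) (SizeLe (All P ⊕ All Q))
¬Dominates-depth-size-longClause s P Q ¬P Q-all =
  ¬Dominates-family _ _ (longClauseFamily s) 0 (longClauseFamily-WF s)
    (λ m → SizeLe-zero (All P) _ (Q-all _ ∷ [])) (λ m → ¬DepthLe (longClauseFamily-invariant s m))
  where
  ¬C : ∀ {m F} → LongClause s m F → ¬ All P F
  ¬C (_ ∷ _ ∷ _ ∷ S , refl , _) (p ∷ []) = ¬P S p
  ¬C (_ ∷ _ ∷ [] , _ , _ , s≤s (s≤s ()))
  ¬C (_ ∷ [] , _ , _ , s≤s ())
  ¬C ([] , _ , _ , ())
  open DepthLowerBound (LongClause s) ¬C LongClause-connected (λ x i → not s , LongClause-restrict s x i)

clauseOn-true-countNeg≤1 : ∀ S → countNeg (clauseOn true S) ≤ 1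
clauseOn-true-countNeg≤1 [] = z≤n
clauseOn-true-countNeg≤1 (_ ∷ S) = clauseOn-true-countNeg≤1 S

clauseOn-false-countPos≤1 : ∀ S → countPos (clauseOn false S) ≤ 1
clauseOn-false-countPos≤1 [] = z≤n
clauseOn-false-countPos≤1 (_ ∷ S) = clauseOn-false-countPos≤1 S

edge : Bool → ℕ → ℕ → Clause
edge s a b = (a , s) ∷ (b , s) ∷ []

clique : Bool → List ℕ → Formula
clique s S = concatMap (λ a → map (edge s a) (remove a S)) S

clique-∈⁻ : ∀ s S {c} → c ∈ clique s S → ∃₂ λ a b → a ∈ S × b ∈ S × b ≢ a × c ≡ edge s a b
clique-∈⁻ s S c∈ with find (∈-concatMap⁻ (λ a → map (edge s a) (remove a S)) {xs = S} c∈)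
... | a , a∈S , c∈row with ∈-map⁻ (edge s a) c∈row
...   | b , b∈rem , refl = let b∈S , b≢a = ∈-remove⁻ a S b∈rem in a , b , a∈S , b∈S , b≢a , refl

clique-∈⁺ : ∀ s {S a b} → a ∈ S → b ∈ S → b ≢ a → edge s a b ∈ clique s S
clique-∈⁺ s a∈S b∈S b≢a = ∈-concatMap⁺ _ (lose a∈S (∈-map⁺ _ (∈-remove⁺ b∈S b≢a)))

edge-untouched : ∀ {x a b} ε s → a ≢ x → b ≢ x → Untouched (single x ε) (edge s a b)
edge-untouched ε s a≢x b≢x = single-≢ ε a≢x ∷ single-≢ ε b≢x ∷ []

reduceClause-edge : ∀ {x s a b c'} → reduceClause (single x s) (edge s a b) ≡ just c' →
  a ≢ x × b ≢ x × c' ≡ edge s a b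
reduceClause-edge {x} {s} {a} {b} eq with a ≟ x | b ≟ x
... | yes refl | _ with () ← trans (sym (reduceClause-satisfied {c = edge s a b} (here refl))) eq
... | _ | yes refl with () ← trans (sym (reduceClause-satisfied {c = edge s a b} (there (here refl)))) eq
... | no a≢x | no b≢x with refl ← trans (sym (reduceClause-untouched _ (edge-untouched s s a≢x b≢x))) eq =
  a≢x , b≢x , refl

Clique : Bool → ℕ → Formula → Set
Clique s m F = ∃ λ S → Unique S × 2 + m ≤ length S × F ⊆ clique s S × clique s S ⊆ F

cliqueFamily : Bool → ℕ → Formula
cliqueFamily s m = clique s (upTo (2 + m))

cliqueFamily-invariant : ∀ s m → Clique s m (cliqueFamily s m)
cliqueFamily-invariant s m =
  upTo (2 + m) , Unique.upTo⁺ _ , ≤-reflexive (sym (length-upTo _)) , (λ c∈ → c∈) , (λ c∈ → c∈)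

All-clique : ∀ {P : Clause → Set} s S → (∀ {a b} → b ≢ a → P (edge s a b)) → All P (clique s S)
All-clique {P} s S P-edge = All.tabulate λ c∈ → P-member (clique-∈⁻ s S c∈)
  where
  P-member : ∀ {c} → (∃₂ λ a b → a ∈ S × b ∈ S × b ≢ a × c ≡ edge s a b) → P c
  P-member (_ , _ , _ , _ , b≢a , refl) = P-edge b≢a

cliqueFamily-WF : ∀ s m → WF (cliqueFamily s m)
cliqueFamily-WF s m =
  All-clique {WFClause} s (upTo (2 + m)) λ b≢a → distinctVars⇒WF ((≢-sym b≢a ∷ []) ∷ [] ∷ [])

cliqueFamily-Krom : ∀ s m → Krom (cliqueFamily s m)
cliqueFamily-Krom s m = All-clique {λ c → length c ≤ 2} s (upTo (2 + m)) λ _ → ≤-refl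

Clique-connected : ∀ {s m F} → Clique s m F → Connected F
Clique-connected {s} (S , _ , _ , F⊆ , ⊆F) c d c∈F d∈F
  with clique-∈⁻ s S (F⊆ c∈F) | clique-∈⁻ s S (F⊆ d∈F)
... | a , _ , a∈S , _ , _ , refl | a' , _ , a'∈S , _ , _ , refl with a' ≟ a
...   | yes refl = step (here c∈F) d∈F (a , here refl , here refl)
...   | no a'≢a  = step (step (here c∈F) (⊆F (clique-∈⁺ s a∈S a'∈S a'≢a)) (a , here refl , here refl))
                     d∈F (a' , there (here refl) , here refl)

Clique-restrict : ∀ s {m F} x → Clique s (suc m) F → Clique s m (restrict F (single x s))
Clique-restrict s {F = F} x (S , u , len , F⊆ , ⊆F) =
  remove x S , remove-unique x u , ≤-pred (≤-trans len (length≤suc-remove x u)) , restrict⊆ , ⊆restrict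
  where
  restrict⊆ : restrict F (single x s) ⊆ clique s (remove x S)
  restrict⊆ c'∈ with restrict-∈⁻ F (single x s) c'∈
  ... | c , c∈F , eq with clique-∈⁻ s S (F⊆ c∈F)
  ...   | a , b , a∈S , b∈S , b≢a , refl with reduceClause-edge {x} {s} {a} {b} eq
  ...     | a≢x , b≢x , refl = clique-∈⁺ s (∈-remove⁺ a∈S a≢x) (∈-remove⁺ b∈S b≢x) b≢a
  ⊆restrict : clique s (remove x S) ⊆ restrict F (single x s)
  ⊆restrict c∈ with clique-∈⁻ s (remove x S) c∈
  ... | a , b , a∈S' , b∈S' , b≢a , refl =
    let a∈S , a≢x = ∈-remove⁻ x S a∈S' ; b∈S , b≢x = ∈-remove⁻ x S b∈S' in
    restrict-∈⁺ F (single x s) (⊆F (clique-∈⁺ s a∈S b∈S b≢a))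
      (reduceClause-untouched (single x s) (edge-untouched s s a≢x b≢x))

¬Dominates-depth-size-clique : ∀ s (P : Clause → Set) → (∀ a b → ¬ P (edge s a b)) →
  ¬ Dominates (DepthLe (All P)) (SizeLe (All P ⊕ Krom))
¬Dominates-depth-size-clique s P ¬P =
  ¬Dominates-family _ _ (cliqueFamily s) 0 (cliqueFamily-WF s)
    (λ m → SizeLe-zero (All P) _ (cliqueFamily-Krom s m)) (λ m → ¬DepthLe (cliqueFamily-invariant s m))
  where
  ¬C : ∀ {m F} → Clique s m F → ¬ All P F
  ¬C (a ∷ b ∷ _ , (a≢ ∷ _) , _ , _ , ⊆F) allP =
    ¬P a b (All.lookup allP (⊆F (clique-∈⁺ s (here refl) (there (here refl)) (≢-sym (All.head a≢)))))
  ¬C (_ ∷ [] , _ , s≤s () , _)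
  ¬C ([] , _ , () , _)
  open DepthLowerBound (Clique s) ¬C Clique-connected (λ x i → s , Clique-restrict s x i)

-- Disjoint gadgets: depth one, unbounded backdoors

block : ℕ → List Bool → Clause
block v [] = []
block v (b ∷ bs) = (v , b) ∷ block (suc v) bs

block-varsC : ∀ v bs {y} → y ∈ varsC (block v bs) → ∃ λ j → j < length bs × y ≡ j + v
block-varsC v (b ∷ bs) (here refl) = 0 , s≤s z≤n , refl
block-varsC v (b ∷ bs) (there y∈) =
  let j , j< , y≡ = block-varsC (suc v) bs y∈ in suc j , s≤s j< , trans y≡ (+-suc j v)

block-tail-∌ : ∀ v bs {y} → y ∈ varsC (block (suc v) bs) → y ≢ v
block-tail-∌ v bs y∈ with block-varsC (suc v) bs y∈
... | j , _ , refl = m+1+n≢n j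

block-unique : ∀ v bs → Unique (varsC (block v bs))
block-unique v [] = []
block-unique v (b ∷ bs) = All.tabulate (λ y∈ → ≢-sym (block-tail-∌ v bs y∈)) ∷ block-unique (suc v) bs

/-block : ∀ {w} .{{_ : NonZero w}} i {j} → j < w → (j + i * w) / w ≡ i
/-block {w} i {j} j<w = begin
  (j + i * w) / w    ≡⟨ +-distrib-/-∣ʳ j (divides-refl i) ⟩
  j / w + i * w / w  ≡⟨ cong₂ _+_ (m<n⇒m/n≡0 j<w) (m*n/n≡m i w) ⟩
  i                  ∎
  where open ≡-Reasoning

module Gadgets (b : Bool) (bs : List Bool) where

  width : ℕ
  width = suc (length bs)

  gadget : ℕ → Clause
  gadget i = block (i * width) (b ∷ bs)

  gadgets : ℕ → Formula
  gadgets n = map gadget (upTo n)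

  gadget∈ : ∀ {n i} → i < n → gadget i ∈ gadgets n
  gadget∈ i<n = ∈-map⁺ gadget (∈-upTo⁺ i<n)

  gadget-index : ∀ i {y} → y ∈ varsC (gadget i) → y / width ≡ i
  gadget-index i y∈ with block-varsC (i * width) (b ∷ bs) y∈
  ... | j , j<w , refl = /-block i j<w

  gadgets-isolated : ∀ n i → Isolated (gadgets n) (gadget i)
  gadgets-isolated n i d∈ (y , y∈i , y∈d) with ∈-map⁻ gadget d∈
  ... | j , _ , refl with refl ← trans (sym (gadget-index i y∈i)) (gadget-index j y∈d) = refl

  gadgets-WF : ∀ n → WF (gadgets n)
  gadgets-WF n = All-map⁺ (All.universal (λ i → distinctVars⇒WF (block-unique (i * width) (b ∷ bs))) _)

  gadget-untouched-tail : ∀ i ε → Untouched (single (i * width) ε) (block (suc (i * width)) bs)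
  gadget-untouched-tail i ε = untouched-varsC λ y∈ → single-≢ ε (block-tail-∌ (i * width) bs y∈)

  gadget-component : ∀ {n i} B σ → i < n → i ∉ map (_/ width) B →
    IsComponent (gadget i ∷ []) (restrict (gadgets n) (onSet B σ))
  gadget-component {n} {i} B σ i<n i∉ = isolated⇒component
    (restrict-∈⁺ (gadgets n) (onSet B σ) (gadget∈ i<n) (reduceClause-untouched (onSet B σ) untouched))
    (isolated-restrict (onSet B σ) (gadgets-isolated n i) untouched)
    where
    untouched : Untouched (onSet B σ) (gadget i)
    untouched = untouched-varsC λ y∈ → onSet-∉ σ λ y∈B →
      i∉ (subst (_∈ map (_/ width) B) (gadget-index i y∈) (∈-map⁺ (_/ width) y∈B))

module GadgetBounds (P Q : Clause → Set) (b : Bool) (bs : List Bool)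
  (¬P : ∀ v → ¬ P (block v (b ∷ bs))) (¬Q : ∀ v → ¬ Q (block v (b ∷ bs)))
  (tailP : ∀ v → P (block v bs)) where

  open Gadgets b bs

  singleGadget-depth : ∀ {G} i → gadget i ∈ G → (∀ {d} → d ∈ G → d ≡ gadget i) → DepthLe (All P) 1 G
  singleGadget-depth {G} i g∈G only =
    split (i * width) (λ allP → ¬P _ (All.lookup allP g∈G)) connected (vars-∈ G g∈G (here refl))
      (inC (restrict-P false)) (inC (restrict-P true))
    where
    connected : Connected G
    connected _ _ c∈G d∈G with refl ← only c∈G | refl ← only d∈G = here c∈G
    restrict-P : ∀ ε → All P (restrict G (single (i * width) ε))
    restrict-P ε = All-restrict G _ λ c∈G eq → reduct-P (only c∈G) eq
      where
      reduct-P : ∀ {c c'} → c ≡ gadget i → reduceClause (single (i * width) ε) c ≡ just c' → P c'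
      reduct-P refl eq
        with refl ← reduceClause-dropHead _ (i * width) b ε (single-self (i * width) ε)
                      (gadget-untouched-tail i ε) eq
        = tailP _

  gadgets-depth : ∀ n → DepthLe (All P) 1 (gadgets (2 + n))
  gadgets-depth n = comps (λ allP → ¬P 0 (All.lookup allP g₀∈)) disconnected component-depth
    where
    g₀∈ : gadget 0 ∈ gadgets (2 + n)
    g₀∈ = gadget∈ (s≤s z≤n)
    g₁∈ : gadget 1 ∈ gadgets (2 + n)
    g₁∈ = gadget∈ (s≤s (s≤s z≤n))
    disconnected : ¬ Connected (gadgets (2 + n))
    disconnected connected with () ← reach-isolated (gadgets-isolated (2 + n) 0) (connected _ _ g₀∈ g₁∈)
    component-depth : ∀ G → IsComponent G (gadgets (2 + n)) → DepthLe (All P) 1 G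
    component-depth G comp@(G⊆F , (c , c∈G) , _) with ∈-map⁻ gadget {xs = upTo (2 + n)} (G⊆F c c∈G)
    ... | i , _ , refl = singleGadget-depth i c∈G (component-isolated comp c∈G (gadgets-isolated (2 + n) i))

  gadgets-¬SizeLe : ∀ n k → k < n → ¬ SizeLe (All P ⊕ All Q) k (gadgets n)
  gadgets-¬SizeLe n k k<n (B , _ , _ , |B|≤k , sizeOK)
    with upTo-missing n (map (_/ width) B) (≤-<-trans (≤-trans (≤-reflexive (length-map _ B)) |B|≤k) k<n)
  ... | i , i<n , i∉ with sizeOK (λ _ → true) (gadget i ∷ []) (gadget-component B _ i<n i∉)
  ...   | inj₁ (p ∷ []) = ¬P _ p
  ...   | inj₂ (q ∷ []) = ¬Q _ q

¬Dominates-size-depth : ∀ (P Q : Clause → Set) b bs →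
  (∀ v → ¬ P (block v (b ∷ bs))) → (∀ v → ¬ Q (block v (b ∷ bs))) → (∀ v → P (block v bs)) →
  ¬ Dominates (SizeLe (All P ⊕ All Q)) (DepthLe (All P))
¬Dominates-size-depth P Q b bs ¬P ¬Q tailP =
  ¬Dominates-family _ _ (λ n → gadgets (2 + n)) 1 (λ n → gadgets-WF (2 + n)) gadgets-depth
    (λ k → gadgets-¬SizeLe (2 + k) k (m≤n⇒m≤1+n (n<1+n k)))
  where
  open Gadgets b bs
  open GadgetBounds P Q b bs ¬P ¬Q tailP

mainTheorem17 : (C C' : BaseClass) → C ≢ C' →
    DominationOrthogonal (SizeLe (⟦ C ⟧ ⊕ ⟦ C' ⟧)) (DepthLe ⟦ C ⟧)
mainTheorem17 horn horn C≢C' = ⊥-elim (C≢C' refl)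
mainTheorem17 dhorn dhorn C≢C' = ⊥-elim (C≢C' refl)
mainTheorem17 krom krom C≢C' = ⊥-elim (C≢C' refl)
mainTheorem17 horn dhorn _ =
  ¬Dominates-size-depth _ _ true (true ∷ false ∷ false ∷ [])
    (λ _ → λ { (s≤s ()) }) (λ _ → λ { (s≤s ()) }) (λ _ → ≤-refl) ,
  ¬Dominates-depth-size-longClause true _ _ (λ _ → λ { (s≤s ()) }) clauseOn-true-countNeg≤1
mainTheorem17 dhorn horn _ =
  ¬Dominates-size-depth _ _ false (false ∷ true ∷ true ∷ [])
    (λ _ → λ { (s≤s ()) }) (λ _ → λ { (s≤s ()) }) (λ _ → ≤-refl) ,
  ¬Dominates-depth-size-longClause false _ _ (λ _ → λ { (s≤s ()) }) clauseOn-false-countPos≤1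
mainTheorem17 horn krom _ =
  ¬Dominates-size-depth _ _ true (true ∷ false ∷ [])
    (λ _ → λ { (s≤s ()) }) (λ _ → λ { (s≤s (s≤s ())) }) (λ _ → ≤-refl) ,
  ¬Dominates-depth-size-clique true _ (λ _ _ → λ { (s≤s ()) })
mainTheorem17 dhorn krom _ =
  ¬Dominates-size-depth _ _ false (false ∷ true ∷ [])
    (λ _ → λ { (s≤s ()) }) (λ _ → λ { (s≤s (s≤s ())) }) (λ _ → ≤-refl) ,
  ¬Dominates-depth-size-clique false _ (λ _ _ → λ { (s≤s ()) })
mainTheorem17 krom horn _ =
  ¬Dominates-size-depth _ _ true (true ∷ true ∷ [])
    (λ _ → λ { (s≤s (s≤s ())) }) (λ _ → λ { (s≤s ()) }) (λ _ → ≤-refl) ,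
  ¬Dominates-depth-size-longClause false _ _ (λ _ → λ { (s≤s (s≤s ())) }) clauseOn-false-countPos≤1
mainTheorem17 krom dhorn _ =
  ¬Dominates-size-depth _ _ false (false ∷ false ∷ [])
    (λ _ → λ { (s≤s (s≤s ())) }) (λ _ → λ { (s≤s ()) }) (λ _ → ≤-refl) ,
  ¬Dominates-depth-size-longClause true _ _ (λ _ → λ { (s≤s (s≤s ())) }) clauseOn-true-countNeg≤1
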